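{- For every snark $G$ one has $\operatorname{rdf}(G)\ge g/2$, where $g$ is the girth of $G$.
   Context: Graphs are finite and undirected; parallel edges and loops are permitted. The girth of a graph is the length of a shortest circuit. A snark is a $2$-connected cubic graph that does not admit a $3$-edge-colouring. A $3$-array of a cubic graph $G$ is a collection $\{M_1,M_2,M_3\}$ of three (not necessarily distinct) perfect matchings of $G$; an edge is uncovered if it belongs to none of them. A $3$-array is regular if $M_1\cap M_2\cap M_3=\emptyset$. The regular defect $\operatorname{rdf}(G)$ is the minimum number of uncovered edges taken over all regular $3$-arrays of $G$ (it is defined whenever $G$ admits a regular $3$-array, which is implicitly assumed). -}

module Defs where

open import Data.Nat using (ℕ; zero; suc; _+_; _*_; _≤_)
open import Data.Fin using (Fin; zero; suc; inject₁; fromℕ)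
open import Data.Fin.Subset using (Subset; _∈_; _∉_; _∩_; _∪_; ∁; ⊥; ∣_∣)
open import Data.Fin.Properties using (_≟_)
open import Data.List using (List; []; _∷_; length; filter; concatMap)
open import Data.List.Base using (allFin)
open import Data.Product using (Σ; ∃; _×_; _,_)
open import Data.Sum using (_⊎_)
open import Data.Unit using (⊤)
open import Function.Definitions using (Injective)
open import Relation.Binary.PropositionalEquality using (_≡_; _≢_)
open import Relation.Nullary using (¬_)

-- A finite multigraph (parallel edges and loops allowed):
-- vertices Fin n, edges Fin m, each edge has two (possibly equal) ends.
record Graph : Set where
  field
    n   : ℕ
    m   : ℕ
    src : Fin m → Fin n
    tgt : Fin m → Fin n

module _ (G : Graph) where
  open Graph G

  V : Set
  V = Fin n

  E : Set
  E = Fin m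

  Joins : E → V → V → Set
  Joins e u v = (src e ≡ u × tgt e ≡ v) ⊎ (src e ≡ v × tgt e ≡ u)

  Incident : E → V → Set
  Incident e v = src e ≡ v ⊎ tgt e ≡ v

  IsLoop : E → Set
  IsLoop e = src e ≡ tgt e

  -- degree: number of edge-ends at v (a loop counts twice)
  degree : V → ℕ
  degree v = length (filter (_≟ v) (concatMap (λ e → src e ∷ tgt e ∷ []) (allFin m)))

  Cubic : Set
  Cubic = ∀ v → degree v ≡ 3

  -- walks all of whose vertices after the first satisfy `ok`
  data Walk (ok : V → Set) : V → V → Set where
    here : ∀ {v} → Walk ok v v
    step : ∀ {u w v} (e : E) → Joins e u w → ok w → Walk ok w v → Walk ok u v

  Connected : Set
  Connected = ∀ u v → Walk (λ _ → ⊤) u v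

  TwoConnected : Set
  TwoConnected = 3 ≤ n × Connected ×
    (∀ w u v → u ≢ w → v ≢ w → Walk (λ x → x ≢ w) u v)

  Is3EdgeColouring : (E → Fin 3) → Set
  Is3EdgeColouring c = (∀ e → ¬ IsLoop e) ×
    (∀ e f v → e ≢ f → Incident e v → Incident f v → c e ≢ c f)

  ThreeEdgeColourable : Set
  ThreeEdgeColourable = Σ (E → Fin 3) Is3EdgeColouring

  Snark : Set
  Snark = TwoConnected × Cubic × ¬ ThreeEdgeColourable

  IsPerfectMatching : Subset m → Set
  IsPerfectMatching M = (∀ e → e ∈ M → ¬ IsLoop e) ×
    (∀ v → Σ E λ e → e ∈ M × Incident e v ×
        (∀ f → f ∈ M → Incident f v → f ≡ e))

  IsRegular3Array : Subset m → Subset m → Subset m → Set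
  IsRegular3Array M₁ M₂ M₃ =
    IsPerfectMatching M₁ × IsPerfectMatching M₂ × IsPerfectMatching M₃ ×
    (M₁ ∩ M₂ ∩ M₃ ≡ ⊥)

  uncovered : Subset m → Subset m → Subset m → ℕ
  uncovered M₁ M₂ M₃ = ∣ ∁ (M₁ ∪ M₂ ∪ M₃) ∣

  IsRdf : ℕ → Set
  IsRdf r =
    (Σ (Subset m) λ M₁ → Σ (Subset m) λ M₂ → Σ (Subset m) λ M₃ →
       IsRegular3Array M₁ M₂ M₃ × uncovered M₁ M₂ M₃ ≡ r) ×
    (∀ M₁ M₂ M₃ → IsRegular3Array M₁ M₂ M₃ → r ≤ uncovered M₁ M₂ M₃)

  -- circuit of length (suc k): distinct vertices v_0..v_k, distinct edges
  -- e_0..e_k with e_i joining v_i and v_{i+1} (indices mod k+1)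
  record Circuit (k : ℕ) : Set where
    field
      vs     : Fin (suc k) → V
      es     : Fin (suc k) → E
      vs-inj : Injective _≡_ _≡_ vs
      es-inj : Injective _≡_ _≡_ es
      joins  : ∀ (i : Fin k) → Joins (es (inject₁ i)) (vs (inject₁ i)) (vs (suc i))
      close  : Joins (es (fromℕ k)) (vs (fromℕ k)) (vs zero)

  HasCircuitOfLength : ℕ → Set
  HasCircuitOfLength zero    = Data.Empty.⊥
    where import Data.Empty
  HasCircuitOfLength (suc k) = Circuit k

  IsGirth : ℕ → Set
  IsGirth g = HasCircuitOfLength g × (∀ l → HasCircuitOfLength l → g ≤ l)

{-# OPTIONS --safe #-}
-- Fix a regular 3-array {A, B, C}. At a vertex incident with an uncovered edge the three
-- matching edges lie on the two remaining edges, and as no edge is in all three matchings,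
-- exactly one of these edges is "doubled" (in two of the matchings). So uncovered and
-- doubled edges form a 2-regular subgraph in which the two kinds alternate: a disjoint
-- union of even circuits, each of length at least g with half of its edges uncovered.
-- If no edge is uncovered, the three matchings form a 3-edge-colouring.
module Submission where

open import Defs
open import Data.Bool using (Bool; true; false; not; if_then_else_)
open import Data.Bool.Properties using (not-involutive; not-¬)
open import Data.Empty using (⊥; ⊥-elim)
open import Data.Fin using (Fin; zero; suc; toℕ; punchIn; punchOut)
open import Data.Fin.Properties
  using (_≟_; any?; pigeonhole; suc-injective; toℕ-injective; toℕ<n; toℕ-inject₁; toℕ-fromℕ;
         punchIn-punchOut; punchOut-injective; punchInᵢ≢i; punchOut-cong; punchOut-punchIn)
open import Data.Fin.Subset using (Subset; _∈_; _∉_; _∪_; _∩_; ∁; ∣_∣) renaming (⊥ to ∅)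
open import Data.Fin.Subset.Properties using (_∈?_; ∉⊥; x∈p∩q⁺; x∈p∪q⁻; x∉p⇒x∈∁p)
open import Data.List using (List; []; _∷_; _++_; length; filter; concatMap; tabulate)
open import Data.List.Properties using (filter-++; length-++)
open import Data.Nat using (ℕ; zero; suc; _+_; _*_; _∸_; _≤_; _<_; _<?_; z≤n; s≤s)
import Data.Nat.Properties as ℕ
open import Data.Nat.Properties
  using (+-0-commutativeMonoid; +-suc; +-comm; +-identityʳ; +-mono-≤; +-monoʳ-≤; +-cancelˡ-≤; *-monoʳ-≤;
         ≤-refl; ≤-reflexive;
         ≤-trans; ≤-<-trans; ≤-pred; <⇒≤; n≤1+n; n<1+n; 1+n≰n; <-cmp; m≤n⇒m<n∨m≡n; m∸n≤m;
         m<n⇒0<n∸m; m+[n∸m]≡n; module ≤-Reasoning)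
open import Algebra.Properties.CommutativeMonoid.Sum +-0-commutativeMonoid
  using (sum; sum-remove; sum-cong-≗; sum-replicate-zero)
open import Data.Product using (∃; ∃₂; Σ; _×_; _,_; proj₁; proj₂)
open import Data.Sum using (_⊎_; inj₁; inj₂; [_,_])
open import Data.Vec using (Vec; []; _∷_; lookup)
open import Data.Vec.Functional using (Vector; removeAt)
open import Data.Vec.Properties using ([]=⇒lookup)
open import Data.Vec.Relation.Unary.All using (All; []; _∷_)
open import Data.Vec.Relation.Unary.All.Properties using (lookup⁺)
open import Data.Vec.Relation.Unary.Unique.Propositional using (Unique; []; _∷_)
open import Data.Vec.Relation.Unary.Unique.Propositional.Properties using (lookup-injective)
open import Function using (_∘_; id)
open import Function.Definitions using (Injective)
open import Relation.Binary.Definitions using (tri<; tri≈; tri>)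
open import Relation.Binary.PropositionalEquality
  using (_≡_; _≢_; refl; sym; trans; cong; subst; module ≡-Reasoning)
open import Relation.Nullary using (¬_; Dec; yes; no)
open import Relation.Nullary.Decidable using (_×-dec_; ¬?)
open import Relation.Unary using (Decidable)

-- Sums over finite index sets

private variable k m : ℕ

positive⇒≤sum : (f : Vector ℕ k) → (∀ i → 1 ≤ f i) → k ≤ sum f
positive⇒≤sum {zero}  f pos = z≤n
positive⇒≤sum {suc k} f pos = +-mono-≤ (pos zero) (positive⇒≤sum (f ∘ suc) (pos ∘ suc))

module PunchedTail (h : Fin (suc k) → Fin (suc m)) (inj : Injective _≡_ _≡_ h) where

  head≢tail : ∀ i → h zero ≢ h (suc i)
  head≢tail i eq with () ← inj eq

  rest : Fin k → Fin m
  rest i = punchOut (head≢tail i)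

  punchIn-rest : ∀ i → punchIn (h zero) (rest i) ≡ h (suc i)
  punchIn-rest i = punchIn-punchOut (head≢tail i)

  rest-injective : Injective _≡_ _≡_ rest
  rest-injective eq = suc-injective (inj (punchOut-injective (head≢tail _) (head≢tail _) eq))

sum-injective-≤ : ∀ (f : Vector ℕ m) (h : Fin k → Fin m) →
  Injective _≡_ _≡_ h → sum (f ∘ h) ≤ sum f
sum-injective-≤ {k = zero} f h inj = z≤n
sum-injective-≤ {zero} {suc k} f h inj with () ← h zero
sum-injective-≤ {suc m} {suc k} f h inj = begin
  f (h zero) + sum (f ∘ h ∘ suc)
    ≡⟨ cong (f (h zero) +_) (sum-cong-≗ (λ i → cong f (sym (punchIn-rest i)))) ⟩
  f (h zero) + sum (removeAt f (h zero) ∘ rest)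
    ≤⟨ +-monoʳ-≤ (f (h zero)) (sum-injective-≤ (removeAt f (h zero)) rest rest-injective) ⟩
  f (h zero) + sum (removeAt f (h zero))
    ≡⟨ sum-remove f ⟨
  sum f ∎
  where
  open PunchedTail h inj
  open ≤-Reasoning

sum-≤-image : ∀ (f : Vector ℕ m) (h : Fin k → Fin m) → Injective _≡_ _≡_ h →
  (∀ e → (∃ λ i → h i ≡ e) ⊎ f e ≡ 0) → sum f ≤ sum (f ∘ h)
sum-≤-image {m} {zero} f h inj supp = ≤-reflexive (trans (sum-cong-≗ vanish) (sum-replicate-zero m))
  where
  vanish : ∀ e → f e ≡ 0
  vanish e with supp e
  ... | inj₂ fe≡0 = fe≡0
sum-≤-image {zero} {suc k} f h inj supp with () ← h zero
sum-≤-image {suc m} {suc k} f h inj supp = begin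
  sum f
    ≡⟨ sum-remove f ⟩
  f (h zero) + sum (removeAt f (h zero))
    ≤⟨ +-monoʳ-≤ (f (h zero)) (sum-≤-image (removeAt f (h zero)) rest rest-injective supp′) ⟩
  f (h zero) + sum (removeAt f (h zero) ∘ rest)
    ≡⟨ cong (f (h zero) +_) (sum-cong-≗ (λ i → cong f (punchIn-rest i))) ⟩
  f (h zero) + sum (f ∘ h ∘ suc) ∎
  where
  open PunchedTail h inj
  open ≤-Reasoning
  supp′ : ∀ j → (∃ λ i → rest i ≡ j) ⊎ removeAt f (h zero) j ≡ 0
  supp′ j with supp (punchIn (h zero) j)
  ... | inj₂ fj≡0 = inj₂ fj≡0
  ... | inj₁ (zero , eq) = ⊥-elim (punchInᵢ≢i (h zero) j (sym eq))
  ... | inj₁ (suc i , eq) = inj₁ (i , trans (punchOut-cong (h zero) eq) (punchOut-punchIn (h zero)))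

indicator : Subset m → Vector ℕ m
indicator p e = if lookup p e then 1 else 0

∣p∣≡sum-indicator : ∀ (p : Subset m) → ∣ p ∣ ≡ sum (indicator p)
∣p∣≡sum-indicator []          = refl
∣p∣≡sum-indicator (true ∷ p)  = cong suc (∣p∣≡sum-indicator p)
∣p∣≡sum-indicator (false ∷ p) = ∣p∣≡sum-indicator p

∈⇒indicator≡1 : ∀ {p : Subset m} {e} → e ∈ p → indicator p e ≡ 1
∈⇒indicator≡1 e∈p = cong (λ b → if b then 1 else 0) ([]=⇒lookup e∈p)

injective⇒≤∣p∣ : ∀ {p : Subset m} (h : Fin k → Fin m) →
  Injective _≡_ _≡_ h → (∀ i → h i ∈ p) → k ≤ ∣ p ∣
injective⇒≤∣p∣ {k = k} {p = p} h inj h∈p = begin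
  k                      ≤⟨ positive⇒≤sum (indicator p ∘ h) (≤-reflexive ∘ sym ∘ ∈⇒indicator≡1 ∘ h∈p) ⟩
  sum (indicator p ∘ h)  ≤⟨ sum-injective-≤ (indicator p) h inj ⟩
  sum (indicator p)      ≡⟨ ∣p∣≡sum-indicator p ⟨
  ∣ p ∣                  ∎
  where open ≤-Reasoning

∩≡∅⇒disjoint : ∀ {A B C : Subset m} → A ∩ B ∩ C ≡ ∅ → ∀ {e} → e ∈ A → e ∈ B → e ∈ C → ⊥
∩≡∅⇒disjoint A∩B∩C≡∅ e∈A e∈B e∈C = ∉⊥ (subst (_ ∈_) A∩B∩C≡∅ (x∈p∩q⁺ (e∈A , x∈p∩q⁺ (e∈B , e∈C))))

-- Least elements and parity

Least : (ℕ → Set) → ℕ → Set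
Least P m = P m × (∀ {k} → k < m → ¬ P k)

least-or-none : ∀ {P : ℕ → Set} → Decidable P → ∀ n →
  (∃ λ m → Least P m) ⊎ (∀ {k} → k ≤ n → ¬ P k)
least-or-none P? zero with P? zero
... | yes p0 = inj₁ (zero , p0 , λ ())
... | no ¬p0 = inj₂ λ { z≤n → ¬p0 }
least-or-none {P} P? (suc n) with least-or-none P? n
... | inj₁ found = inj₁ found
... | inj₂ none with P? (suc n)
...   | yes psn = inj₁ (suc n , psn , λ { (s≤s k≤n) → none k≤n })
...   | no ¬psn = inj₂ λ k≤sn → below (m≤n⇒m<n∨m≡n k≤sn)
  where
  below : ∀ {k} → k < suc n ⊎ k ≡ suc n → ¬ P k
  below (inj₁ (s≤s k≤n)) = none k≤n
  below (inj₂ refl)      = ¬psn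

least : ∀ {P : ℕ → Set} → Decidable P → ∀ {n} → P n → ∃ λ m → Least P m
least P? {n} pn with least-or-none P? n
... | inj₁ found = found
... | inj₂ none  = ⊥-elim (none ≤-refl pn)

parity : ℕ → Bool
parity zero    = true
parity (suc t) = not (parity t)

parity-+-double : ∀ i k → parity (i + (k + k)) ≡ parity i
parity-+-double zero    zero    = refl
parity-+-double (suc i) k       = cong not (parity-+-double i k)
parity-+-double zero    (suc k) rewrite +-suc k k =
  trans (not-involutive (parity (k + k))) (parity-+-double zero k)

even-or-odd : ∀ n → (∃ λ k → n ≡ k + k) ⊎ (∃ λ k → n ≡ suc (k + k))
even-or-odd zero = inj₁ (0 , refl)
even-or-odd (suc n) with even-or-odd n
... | inj₁ (k , refl) = inj₂ (k , refl)
... | inj₂ (k , refl) = inj₁ (suc k , cong suc (sym (+-suc k k)))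

double-injective : ∀ {i j} → i + i ≡ j + j → i ≡ j
double-injective {zero}  {zero}  _  = refl
double-injective {suc i} {suc j} eq rewrite +-suc i i | +-suc j j =
  cong suc (double-injective (ℕ.suc-injective (ℕ.suc-injective eq)))

-- Incidence and perfect matchings

module Incidence (G : Graph) where
  open Graph G

  incident? : ∀ e v → Dec (Incident G e v)
  incident? e v with src e ≟ v | tgt e ≟ v
  ... | yes s | _     = yes (inj₁ s)
  ... | no _  | yes t = yes (inj₂ t)
  ... | no ¬s | no ¬t = no λ { (inj₁ s) → ¬s s ; (inj₂ t) → ¬t t }

  joins-sym : ∀ {e u v} → Joins G e u v → Joins G e v u
  joins-sym (inj₁ (s , t)) = inj₂ (s , t)
  joins-sym (inj₂ (s , t)) = inj₁ (s , t)

  joins-functional : ∀ {e u v w} → Joins G e u v → Joins G e u w → v ≡ w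
  joins-functional (inj₁ (s , t)) (inj₁ (s′ , t′)) = trans (sym t) t′
  joins-functional (inj₁ (s , t)) (inj₂ (s′ , t′)) = trans (sym t) (trans t′ (trans (sym s) s′))
  joins-functional (inj₂ (s , t)) (inj₁ (s′ , t′)) = trans (sym s) (trans s′ (trans (sym t) t′))
  joins-functional (inj₂ (s , t)) (inj₂ (s′ , t′)) = trans (sym s) s′

  joins-endpoint : ∀ {e u v u′ v′} → Joins G e u v → Joins G e u′ v′ → u′ ≡ u ⊎ u′ ≡ v
  joins-endpoint (inj₁ (s , t)) (inj₁ (s′ , _)) = inj₁ (trans (sym s′) s)
  joins-endpoint (inj₁ (s , t)) (inj₂ (_ , t′)) = inj₂ (trans (sym t′) t)
  joins-endpoint (inj₂ (s , t)) (inj₁ (s′ , _)) = inj₂ (trans (sym s′) s)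
  joins-endpoint (inj₂ (s , t)) (inj₂ (_ , t′)) = inj₁ (trans (sym t′) t)

  joins-loop : ∀ {e v} → Joins G e v v → IsLoop G e
  joins-loop (inj₁ (s , t)) = trans s (sym t)
  joins-loop (inj₂ (s , t)) = trans s (sym t)

  joins⇒incidentʳ : ∀ {e u v} → Joins G e u v → Incident G e v
  joins⇒incidentʳ (inj₁ (_ , t)) = inj₂ t
  joins⇒incidentʳ (inj₂ (s , _)) = inj₁ s

  otherEnd : E G → V G → V G
  otherEnd e v with src e ≟ v
  ... | yes _ = tgt e
  ... | no _  = src e

  joins-otherEnd : ∀ {e v} → Incident G e v → Joins G e v (otherEnd e v)
  joins-otherEnd {e} {v} inc with src e ≟ v | inc
  ... | yes s | _      = inj₁ (s , refl)
  ... | no ¬s | inj₁ s = ⊥-elim (¬s s)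
  ... | no _  | inj₂ t = inj₂ (refl , t)

  endpoints : E G → List (V G)
  endpoints e = src e ∷ tgt e ∷ []

  ends : V G → E G → ℕ
  ends v e = length (filter (_≟ v) (endpoints e))

  degree≡sum-ends : ∀ v → degree G v ≡ sum (ends v)
  degree≡sum-ends v = count id
    where
    count : ∀ {k} (h : Fin k → E G) →
      length (filter (_≟ v) (concatMap endpoints (tabulate h))) ≡ sum (ends v ∘ h)
    count {zero}  h = refl
    count {suc k} h = begin
      length (filter (_≟ v) (endpoints (h zero) ++ rest))
        ≡⟨ cong length (filter-++ (_≟ v) (endpoints (h zero)) rest) ⟩
      length (filter (_≟ v) (endpoints (h zero)) ++ filter (_≟ v) rest)
        ≡⟨ length-++ (filter (_≟ v) (endpoints (h zero))) ⟩
      ends v (h zero) + length (filter (_≟ v) rest)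
        ≡⟨ cong (ends v (h zero) +_) (count (h ∘ suc)) ⟩
      sum (ends v ∘ h) ∎
      where
      open ≡-Reasoning
      rest = concatMap endpoints (tabulate (h ∘ suc))

  incident⇒ends≥1 : ∀ {e v} → Incident G e v → 1 ≤ ends v e
  incident⇒ends≥1 {e} {v} inc with src e ≟ v
  ... | yes _ = s≤s z≤n
  ... | no ¬s with tgt e ≟ v | inc
  ...   | yes _ | _      = s≤s z≤n
  ...   | no _  | inj₁ s = ⊥-elim (¬s s)
  ...   | no ¬t | inj₂ t = ⊥-elim (¬t t)

  loop⇒ends≥2 : ∀ {e v} → IsLoop G e → Incident G e v → 2 ≤ ends v e
  loop⇒ends≥2 {e} {v} loop inc with src e ≟ v
  ... | no ¬s = ⊥-elim (¬s ([ id , trans loop ] inc))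
  ... | yes s with tgt e ≟ v
  ...   | yes _ = ≤-refl
  ...   | no ¬t = ⊥-elim (¬t (trans (sym loop) s))

  nonLoop⇒ends≤1 : ∀ {e v} → ¬ IsLoop G e → ends v e ≤ 1
  nonLoop⇒ends≤1 {e} {v} ¬loop with src e ≟ v
  ... | yes s with tgt e ≟ v
  ...   | yes t = ⊥-elim (¬loop (trans s (sym t)))
  ...   | no _  = ≤-refl
  nonLoop⇒ends≤1 {e} {v} ¬loop | no _ with tgt e ≟ v
  ...   | yes _ = ≤-refl
  ...   | no _  = z≤n

  nonIncident⇒ends≡0 : ∀ {e v} → ¬ Incident G e v → ends v e ≡ 0
  nonIncident⇒ends≡0 {e} {v} ¬inc with src e ≟ v
  ... | yes s = ⊥-elim (¬inc (inj₁ s))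
  ... | no _ with tgt e ≟ v
  ...   | yes t = ⊥-elim (¬inc (inj₂ t))
  ...   | no _  = refl

module PerfectMatching {G : Graph} {M : Subset (Graph.m G)} (pm : IsPerfectMatching G M) where

  matched : V G → E G
  matched v = proj₁ (proj₂ pm v)

  matched-∈ : ∀ v → matched v ∈ M
  matched-∈ v = proj₁ (proj₂ (proj₂ pm v))

  matched-incident : ∀ v → Incident G (matched v) v
  matched-incident v = proj₁ (proj₂ (proj₂ (proj₂ pm v)))

  matched-unique : ∀ {e v} → e ∈ M → Incident G e v → e ≡ matched v
  matched-unique {e} {v} = proj₂ (proj₂ (proj₂ (proj₂ pm v))) e

  ∈⇒nonLoop : ∀ {e} → e ∈ M → ¬ IsLoop G e
  ∈⇒nonLoop = proj₁ pm _

-- Cubic graphs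

module _ {G : Graph} (cubic : Cubic G) where
  open Incidence G

  sum-ends≤3 : ∀ {k} v (h : Fin k → E G) → Injective _≡_ _≡_ h → sum (ends v ∘ h) ≤ 3
  sum-ends≤3 v h inj = begin
    sum (ends v ∘ h) ≤⟨ sum-injective-≤ (ends v) h inj ⟩
    sum (ends v)     ≡⟨ degree≡sum-ends v ⟨
    degree G v       ≡⟨ cubic v ⟩
    3                ∎
    where open ≤-Reasoning

  distinct-incident≤3 : ∀ v {k} {es : Vec (E G) k} → Unique es → All (λ e → Incident G e v) es → k ≤ 3
  distinct-incident≤3 v {es = es} distinct incident =
    ≤-trans (positive⇒≤sum (ends v ∘ lookup es) (incident⇒ends≥1 ∘ lookup⁺ incident))
            (sum-ends≤3 v (lookup es) (lookup-injective distinct _ _))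

  loop-distinct-incident≤1 : ∀ v {k a} {es : Vec (E G) k} → IsLoop G a → Unique (a ∷ es) →
    All (λ e → Incident G e v) (a ∷ es) → k ≤ 1
  loop-distinct-incident≤1 v {k} {a} {es} loop distinct (a~v ∷ incident) = +-cancelˡ-≤ 2 k 1 (begin
    2 + k                          ≤⟨ +-mono-≤ (loop⇒ends≥2 loop a~v)
                                        (positive⇒≤sum (ends v ∘ lookup es) (incident⇒ends≥1 ∘ lookup⁺ incident)) ⟩
    sum (ends v ∘ lookup (a ∷ es)) ≤⟨ sum-ends≤3 v (lookup (a ∷ es)) (lookup-injective distinct _ _) ⟩
    3                              ∎)
    where open ≤-Reasoning

  third-incident-edge : ∀ v {a b} → a ≢ b → ¬ IsLoop G a → ¬ IsLoop G b →
    ∃ λ c → c ≢ a × c ≢ b × Incident G c v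
  third-incident-edge v {a} {b} a≢b ¬loop-a ¬loop-b with
    any? (λ c → ¬? (c ≟ a) ×-dec ¬? (c ≟ b) ×-dec incident? c v)
  ... | yes found = found
  ... | no none = ⊥-elim (1+n≰n three≤two)
    where
    h : Fin 2 → E G
    h = lookup (a ∷ b ∷ [])
    injective : Injective _≡_ _≡_ h
    injective = lookup-injective ((a≢b ∷ []) ∷ [] ∷ []) _ _
    supported : ∀ c → (∃ λ i → h i ≡ c) ⊎ ends v c ≡ 0
    supported c with c ≟ a | c ≟ b
    ... | yes c≡a | _     = inj₁ (zero , sym c≡a)
    ... | no _    | yes c≡b = inj₁ (suc zero , sym c≡b)
    ... | no c≢a  | no c≢b  = inj₂ (nonIncident⇒ends≡0 λ inc → none (c , c≢a , c≢b , inc))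
    three≤two : 3 ≤ 2
    three≤two = begin
      3                ≡⟨ cubic v ⟨
      degree G v       ≡⟨ degree≡sum-ends v ⟩
      sum (ends v)     ≤⟨ sum-≤-image (ends v) h injective supported ⟩
      sum (ends v ∘ h) ≤⟨ +-mono-≤ (nonLoop⇒ends≤1 ¬loop-a) (+-mono-≤ (nonLoop⇒ends≤1 ¬loop-b) z≤n) ⟩
      2                ∎
      where open ≤-Reasoning

-- Alternating walks

module AlternatingWalk {G : Graph} {S : Set}
  (vertex : S → V G) (edge : Bool → S → E G) (move : Bool → S → S)
  (edge-joins : ∀ b s → Joins G (edge b s) (vertex s) (vertex (move b s)))
  (edge-determined : ∀ b {s s′} → vertex s ≡ vertex s′ → edge b s ≡ edge b s′)
  (edge-back : ∀ b s → edge b (move b s) ≡ edge b s)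
  (edge-nonLoop : ∀ b s → ¬ IsLoop G (edge b s))
  (edge-kind : ∀ {b b′} s s′ → edge b s ≡ edge b′ s′ → b ≡ b′)
  (s₀ : S) where
  open Incidence G

  walk : ℕ → S
  walk zero    = s₀
  walk (suc t) = move (parity t) (walk t)

  x : ℕ → V G
  x t = vertex (walk t)

  ε : ℕ → E G
  ε t = edge (parity t) (walk t)

  ε-joins : ∀ t → Joins G (ε t) (x t) (x (suc t))
  ε-joins t = edge-joins (parity t) (walk t)

  ε-after : ∀ t → ε t ≡ edge (parity t) (walk (suc t))
  ε-after t = sym (edge-back (parity t) (walk t))

  edge-at : ∀ {b b′} i j → b ≡ b′ → x i ≡ x j → edge b (walk i) ≡ edge b′ (walk j)
  edge-at i j refl = edge-determined _

  same-step : ∀ {e e′ u u′ v v′} → e ≡ e′ → u ≡ u′ → Joins G e u v → Joins G e′ u′ v′ → v ≡ v′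
  same-step refl refl = joins-functional

  backward : ∀ i j → parity i ≡ parity j → x (suc i) ≡ x (suc j) → x i ≡ x j
  backward i j p eq =
    same-step (trans (ε-after i) (trans (edge-at (suc i) (suc j) p eq) (sym (ε-after j)))) eq
      (joins-sym (ε-joins i)) (joins-sym (ε-joins j))

  turn : ∀ i j → parity i ≡ parity j → x i ≡ x (suc j) → x (suc i) ≡ x j
  turn i j p eq = same-step (trans (edge-at i (suc j) p eq) (sym (ε-after j))) eq
    (ε-joins i) (joins-sym (ε-joins j))

  moves : ∀ t → x t ≢ x (suc t)
  moves t eq =
    edge-nonLoop (parity t) (walk t) (joins-loop (subst (Joins G (ε t) (x t)) (sym eq) (ε-joins t)))

  -- The edge used at a step is determined by either end of the step together with the parity
  -- of the time, so a repetition x i ≡ x j can be moved inwards (turn) or backwards (backward):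
  -- at odd distance this ends in a step that is a loop, at even distance it reaches time 0.
  no-odd-return : ∀ k i → x i ≢ x (i + suc (k + k))
  no-odd-return zero    i eq = moves i (trans eq (cong x (+-comm i 1)))
  no-odd-return (suc k) i eq =
    no-odd-return k (suc i)
      (trans (turn i (i + (suc k + suc k)) p (trans eq (cong x (+-suc i _)))) (cong x j≡))
    where
    p : parity i ≡ parity (i + (suc k + suc k))
    p = sym (parity-+-double i (suc k))
    j≡ : i + (suc k + suc k) ≡ suc i + suc (k + k)
    j≡ = trans (cong (λ n → i + suc n) (+-suc k k)) (+-suc i (suc (k + k)))

  even-return : ∀ i k → x i ≡ x (i + (k + k)) → x 0 ≡ x (k + k)
  even-return zero    k eq = eq
  even-return (suc i) k eq = even-return i k (backward i (i + (k + k)) (sym (parity-+-double i k)) eq)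

  return : ∀ i d → x i ≡ x (i + d) → x 0 ≡ x d
  return i d eq with even-or-odd d
  ... | inj₁ (k , refl) = even-return i k eq
  ... | inj₂ (k , refl) = ⊥-elim (no-odd-return k i eq)

  Returns : ℕ → Set
  Returns d = 0 < d × x 0 ≡ x d

  some-return : ∃ Returns
  some-return with pigeonhole (n<1+n (Graph.n G)) (x ∘ toℕ)
  ... | i , j , i<j , eq = toℕ j ∸ toℕ i , m<n⇒0<n∸m i<j ,
          return (toℕ i) _ (trans eq (cong x (sym (m+[n∸m]≡n (<⇒≤ i<j)))))

  first-return : ∃ λ k → x 0 ≡ x (suc k + suc k) × (∀ {a b} → a < b → b < suc k + suc k → x a ≢ x b)
  first-return with least (λ d → 0 <? d ×-dec x 0 ≟ x d) (proj₂ some-return)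
  ... | d , (0<d , closes) , minimal with even-or-odd d
  ...   | inj₂ (k , refl) = ⊥-elim (no-odd-return k 0 closes)
  ...   | inj₁ (zero , refl) with () ← 0<d
  ...   | inj₁ (suc k , refl) = k , closes , simple
    where
    simple : ∀ {a b} → a < b → b < suc k + suc k → x a ≢ x b
    simple {a} {b} a<b b<d eq = minimal (≤-<-trans (m∸n≤m b a) b<d)
      (m<n⇒0<n∸m a<b , return a (b ∸ a) (trans eq (cong x (sym (m+[n∸m]≡n (<⇒≤ a<b))))))

  module Closed (k : ℕ) (closes : x 0 ≡ x (suc k + suc k))
    (simple : ∀ {a b} → a < b → b < suc k + suc k → x a ≢ x b) where

    len : ℕ
    len = suc k + suc k

    x-injective : ∀ {a b} → a < len → b < len → x a ≡ x b → a ≡ b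
    x-injective {a} {b} a<len b<len eq with <-cmp a b
    ... | tri< a<b _ _ = ⊥-elim (simple a<b b<len eq)
    ... | tri≈ _ a≡b _ = a≡b
    ... | tri> _ _ b<a = ⊥-elim (simple b<a a<len (sym eq))

    ε-distinct : ∀ {a b} → a < b → b < len → ε a ≢ ε b
    ε-distinct {a} {b} a<b b<len eq
      with joins-endpoint (ε-joins a) (subst (λ e → Joins G e (x b) (x (suc b))) (sym eq) (ε-joins b))
    ... | inj₁ xb≡xa = simple a<b b<len (sym xb≡xa)
    ... | inj₂ xb≡xa+1 with m≤n⇒m<n∨m≡n a<b
    ...   | inj₁ a+1<b = simple a+1<b b<len (sym xb≡xa+1)
    ...   | inj₂ refl  = not-¬ refl (edge-kind (walk a) (walk (suc a)) eq)

    ε-injective : ∀ {a b} → a < len → b < len → ε a ≡ ε b → a ≡ b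
    ε-injective {a} {b} a<len b<len eq with <-cmp a b
    ... | tri< a<b _ _ = ⊥-elim (ε-distinct a<b b<len eq)
    ... | tri≈ _ a≡b _ = a≡b
    ... | tri> _ _ b<a = ⊥-elim (ε-distinct b<a a<len (sym eq))

    circuit : Circuit G (k + suc k)
    circuit = record
      { vs     = x ∘ toℕ
      ; es     = ε ∘ toℕ
      ; vs-inj = λ eq → toℕ-injective (x-injective (toℕ<n _) (toℕ<n _) eq)
      ; es-inj = λ eq → toℕ-injective (ε-injective (toℕ<n _) (toℕ<n _) eq)
      ; joins  = λ i → subst (λ t → Joins G (ε t) (x t) (x (suc (toℕ i)))) (sym (toℕ-inject₁ i))
                           (ε-joins (toℕ i))
      ; close  = subst (λ t → Joins G (ε t) (x t) (x 0)) (sym (toℕ-fromℕ (k + suc k)))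
                   (subst (Joins G (ε (k + suc k)) (x (k + suc k))) (sym closes) (ε-joins (k + suc k)))
      }

    evenTime : Fin (suc k) → ℕ
    evenTime i = toℕ i + toℕ i

    evenTime<len : ∀ i → evenTime i < len
    evenTime<len i = s≤s (≤-trans (+-mono-≤ i≤k i≤k) (+-monoʳ-≤ k (n≤1+n k)))
      where i≤k = ≤-pred (toℕ<n i)

    even-edges-injective : Injective _≡_ _≡_ (edge true ∘ walk ∘ evenTime)
    even-edges-injective {i} {j} eq = toℕ-injective (double-injective
      (ε-injective (evenTime<len i) (evenTime<len j)
        (trans (cong (λ b → edge b (walk (evenTime i))) (parity-+-double 0 (toℕ i)))
          (trans eq (cong (λ b → edge b (walk (evenTime j))) (sym (parity-+-double 0 (toℕ j))))))))

  alternating-circuit : ∃ λ k → Circuit G (k + suc k) ×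
    Σ (Fin (suc k) → S) λ h → Injective _≡_ _≡_ (edge true ∘ h)
  alternating-circuit with first-return
  ... | k , closes , simple = k , circuit , walk ∘ evenTime , even-edges-injective
    where open Closed k closes simple

-- Three perfect matchings of a cubic graph

shared-edge⇒uncovered-neighbour : ∀ {G : Graph} → Cubic G → ∀ {M N K : Subset (Graph.m G)} →
  IsPerfectMatching G M → IsPerfectMatching G N → IsPerfectMatching G K →
  (∀ {e} → e ∈ M → e ∈ N → e ∈ K → ⊥) →
  ∀ {d y} → d ∈ M → d ∈ N → Incident G d y → ∃ λ c → (c ∉ M × c ∉ N × c ∉ K) × Incident G c y
shared-edge⇒uncovered-neighbour {G} cubic pmM pmN pmK regular {d} {y} d∈M d∈N d~y
  with third-incident-edge cubic y d≢k (PM.∈⇒nonLoop d∈M) (PK.∈⇒nonLoop (PK.matched-∈ y))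
  where
  module PM = PerfectMatching pmM
  module PK = PerfectMatching pmK
  d≢k : d ≢ PK.matched y
  d≢k d≡k = regular d∈M d∈N (subst (_∈ _) (sym d≡k) (PK.matched-∈ y))
... | c , c≢d , c≢k , c~y =
  c , (avoids pmM d∈M , avoids pmN d∈N , λ c∈K → c≢k (PK.matched-unique c∈K c~y)) , c~y
  where
  module PK = PerfectMatching pmK
  avoids : ∀ {L} → IsPerfectMatching G L → d ∈ L → c ∉ L
  avoids pmL d∈L c∈L = c≢d (trans (matched-unique c∈L c~y) (sym (matched-unique d∈L d~y)))
    where open PerfectMatching pmL

module ThreeMatchings {G : Graph} {A B C : Subset (Graph.m G)}
  (pmA : IsPerfectMatching G A) (pmB : IsPerfectMatching G B) (pmC : IsPerfectMatching G C) where

  Uncovered : E G → Set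
  Uncovered e = e ∉ A × e ∉ B × e ∉ C

  Covered : E G → Set
  Covered e = e ∈ A ⊎ e ∈ B ⊎ e ∈ C

  uncovered? : Decidable Uncovered
  uncovered? e = ¬? (e ∈? A) ×-dec ¬? (e ∈? B) ×-dec ¬? (e ∈? C)

  ¬uncovered⇒covered : ∀ {e} → ¬ Uncovered e → Covered e
  ¬uncovered⇒covered {e} ¬u with e ∈? A | e ∈? B | e ∈? C
  ... | yes e∈A | _       | _       = inj₁ e∈A
  ... | no _    | yes e∈B | _       = inj₂ (inj₁ e∈B)
  ... | no _    | no _    | yes e∈C = inj₂ (inj₂ e∈C)
  ... | no e∉A  | no e∉B  | no e∉C  = ⊥-elim (¬u (e∉A , e∉B , e∉C))

  uncovered≢covered : ∀ {u e} → Uncovered u → Covered e → u ≢ e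
  uncovered≢covered (u∉A , _ , _) (inj₁ e∈A)        refl = u∉A e∈A
  uncovered≢covered (_ , u∉B , _) (inj₂ (inj₁ e∈B)) refl = u∉B e∈B
  uncovered≢covered (_ , _ , u∉C) (inj₂ (inj₂ e∈C)) refl = u∉C e∈C

  uncovered⇒∈∁ : ∀ {e} → Uncovered e → e ∈ ∁ (A ∪ B ∪ C)
  uncovered⇒∈∁ {e} (e∉A , e∉B , e∉C) = x∉p⇒x∈∁p λ e∈ →
    [ e∉A , (λ e∈B∪C → [ e∉B , e∉C ] (x∈p∪q⁻ B C e∈B∪C)) ] (x∈p∪q⁻ A (B ∪ C) e∈)

  matching : Fin 3 → Subset (Graph.m G)
  matching zero             = A
  matching (suc zero)       = B
  matching (suc (suc zero)) = C

  matching-perfect : ∀ i → IsPerfectMatching G (matching i)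
  matching-perfect zero             = pmA
  matching-perfect (suc zero)       = pmB
  matching-perfect (suc (suc zero)) = pmC

  colour : E G → Fin 3
  colour e with e ∈? A | e ∈? B
  ... | yes _ | _     = zero
  ... | no _  | yes _ = suc zero
  ... | no _  | no _  = suc (suc zero)

  ∈-colour : ∀ {e} → Covered e → e ∈ matching (colour e)
  ∈-colour {e} covered with e ∈? A | e ∈? B | covered
  ... | yes e∈A | _       | _                 = e∈A
  ... | no _    | yes e∈B | _                 = e∈B
  ... | no e∉A  | _       | inj₁ e∈A          = ⊥-elim (e∉A e∈A)
  ... | no _    | no e∉B  | inj₂ (inj₁ e∈B)   = ⊥-elim (e∉B e∈B)
  ... | no _    | no _    | inj₂ (inj₂ e∈C)   = e∈C

  covering⇒colourable : (∀ e → Covered e) → ThreeEdgeColourable G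
  covering⇒colourable covered = colour , nonLoop , proper
    where
    nonLoop : ∀ e → ¬ IsLoop G e
    nonLoop e = PerfectMatching.∈⇒nonLoop (matching-perfect (colour e)) (∈-colour (covered e))
    proper : ∀ e f v → e ≢ f → Incident G e v → Incident G f v → colour e ≢ colour f
    proper e f v e≢f e~v f~v same = e≢f (trans (matched-unique (∈-colour (covered e)) e~v)
      (sym (matched-unique (subst (λ i → f ∈ matching i) (sym same) (∈-colour (covered f))) f~v)))
      where open PerfectMatching (matching-perfect (colour e))

  uncovered-edge : ¬ ThreeEdgeColourable G → ∃ Uncovered
  uncovered-edge ¬colourable with any? uncovered?
  ... | yes found = found
  ... | no none   =
    ⊥-elim (¬colourable (covering⇒colourable λ e → ¬uncovered⇒covered (λ u → none (e , u))))

module RegularArray {G : Graph} (cubic : Cubic G) {A B C : Subset (Graph.m G)}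
  (pmA : IsPerfectMatching G A) (pmB : IsPerfectMatching G B) (pmC : IsPerfectMatching G C)
  (regular : ∀ {e} → e ∈ A → e ∈ B → e ∈ C → ⊥) where

  open Incidence G
  open ThreeMatchings pmA pmB pmC
  module PA = PerfectMatching pmA
  module PB = PerfectMatching pmB
  module PC = PerfectMatching pmC

  Doubled : E G → Set
  Doubled e = (e ∈ A × e ∈ B) ⊎ (e ∈ A × e ∈ C) ⊎ (e ∈ B × e ∈ C)

  doubled⇒covered : ∀ {e} → Doubled e → Covered e
  doubled⇒covered (inj₁ (e∈A , _))        = inj₁ e∈A
  doubled⇒covered (inj₂ (inj₁ (e∈A , _))) = inj₁ e∈A
  doubled⇒covered (inj₂ (inj₂ (e∈B , _))) = inj₂ (inj₁ e∈B)

  doubled⇒nonLoop : ∀ {e} → Doubled e → ¬ IsLoop G e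
  doubled⇒nonLoop (inj₁ (e∈A , _))        = PA.∈⇒nonLoop e∈A
  doubled⇒nonLoop (inj₂ (inj₁ (e∈A , _))) = PA.∈⇒nonLoop e∈A
  doubled⇒nonLoop (inj₂ (inj₂ (e∈B , _))) = PB.∈⇒nonLoop e∈B

  two-covered-incident : ∀ v → ∃₂ λ p q → p ≢ q × Covered p × Covered q × Incident G p v × Incident G q v
  two-covered-incident v with PA.matched v ≟ PB.matched v
  ... | no a≢b = _ , _ , a≢b , inj₁ (PA.matched-∈ v) , inj₂ (inj₁ (PB.matched-∈ v)) ,
                 PA.matched-incident v , PB.matched-incident v
  ... | yes a≡b with PA.matched v ≟ PC.matched v
  ...   | no a≢c = _ , _ , a≢c , inj₁ (PA.matched-∈ v) , inj₂ (inj₂ (PC.matched-∈ v)) ,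
                   PA.matched-incident v , PC.matched-incident v
  ...   | yes a≡c = ⊥-elim (regular (PA.matched-∈ v) (subst (_∈ B) (sym a≡b) (PB.matched-∈ v))
                                      (subst (_∈ C) (sym a≡c) (PC.matched-∈ v)))

  uncovered-nonLoop : ∀ {u v} → Uncovered u → Incident G u v → ¬ IsLoop G u
  uncovered-nonLoop {u} {v} u-unc u~v loop with two-covered-incident v
  ... | p , q , p≢q , p-cov , q-cov , p~v , q~v = 1+n≰n (loop-distinct-incident≤1 cubic v loop
    ((uncovered≢covered u-unc p-cov ∷ uncovered≢covered u-unc q-cov ∷ []) ∷ (p≢q ∷ []) ∷ [] ∷ [])
    (u~v ∷ p~v ∷ q~v ∷ []))

  uncovered-unique : ∀ {u u′ v} → Uncovered u → Uncovered u′ → Incident G u v → Incident G u′ v → u ≡ u′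
  uncovered-unique {u} {u′} {v} u-unc u′-unc u~v u′~v with u ≟ u′ | two-covered-incident v
  ... | yes u≡u′ | _ = u≡u′
  ... | no u≢u′ | p , q , p≢q , p-cov , q-cov , p~v , q~v = ⊥-elim (1+n≰n (distinct-incident≤3 cubic v
    ((u≢u′ ∷ uncovered≢covered u-unc p-cov ∷ uncovered≢covered u-unc q-cov ∷ []) ∷
     (uncovered≢covered u′-unc p-cov ∷ uncovered≢covered u′-unc q-cov ∷ []) ∷ (p≢q ∷ []) ∷ [] ∷ [])
    (u~v ∷ u′~v ∷ p~v ∷ q~v ∷ [])))

  -- Meaningful only at vertices with an uncovered edge, where two of the three matching edges
  -- coincide (doubledEdge-doubled); elsewhere it is just the edge of C.
  doubledEdge : V G → E G
  doubledEdge v with PA.matched v ≟ PB.matched v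
  ... | yes _ = PA.matched v
  ... | no _  = PC.matched v

  doubledEdge-incident : ∀ v → Incident G (doubledEdge v) v
  doubledEdge-incident v with PA.matched v ≟ PB.matched v
  ... | yes _ = PA.matched-incident v
  ... | no _  = PC.matched-incident v

  doubledEdge-doubled : ∀ {u v} → Uncovered u → Incident G u v → Doubled (doubledEdge v)
  doubledEdge-doubled {u} {v} u-unc u~v with PA.matched v ≟ PB.matched v
  ... | yes a≡b = inj₁ (PA.matched-∈ v , subst (_∈ B) (sym a≡b) (PB.matched-∈ v))
  ... | no a≢b with PC.matched v ≟ PA.matched v | PC.matched v ≟ PB.matched v
  ...   | yes c≡a | _ = inj₂ (inj₁ (subst (_∈ A) (sym c≡a) (PA.matched-∈ v) , PC.matched-∈ v))
  ...   | no _ | yes c≡b = inj₂ (inj₂ (subst (_∈ B) (sym c≡b) (PB.matched-∈ v) , PC.matched-∈ v))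
  ...   | no c≢a | no c≢b = ⊥-elim (1+n≰n (distinct-incident≤3 cubic v
    ((uncovered≢covered u-unc (inj₁ (PA.matched-∈ v)) ∷
      uncovered≢covered u-unc (inj₂ (inj₁ (PB.matched-∈ v))) ∷
      uncovered≢covered u-unc (inj₂ (inj₂ (PC.matched-∈ v))) ∷ []) ∷
     (a≢b ∷ c≢a ∘ sym ∷ []) ∷ (c≢b ∘ sym ∷ []) ∷ [] ∷ [])
    (u~v ∷ PA.matched-incident v ∷ PB.matched-incident v ∷ PC.matched-incident v ∷ [])))

  doubled⇒doubledEdge : ∀ {d v} → Doubled d → Incident G d v → d ≡ doubledEdge v
  doubled⇒doubledEdge {d} {v} doubled d~v with PA.matched v ≟ PB.matched v | doubled
  ... | yes _   | inj₁ (d∈A , _)        = PA.matched-unique d∈A d~v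
  ... | yes _   | inj₂ (inj₁ (d∈A , _)) = PA.matched-unique d∈A d~v
  ... | yes a≡b | inj₂ (inj₂ (d∈B , _)) = trans (PB.matched-unique d∈B d~v) (sym a≡b)
  ... | no a≢b  | inj₁ (d∈A , d∈B)      =
    ⊥-elim (a≢b (trans (sym (PA.matched-unique d∈A d~v)) (PB.matched-unique d∈B d~v)))
  ... | no _    | inj₂ (inj₁ (_ , d∈C)) = PC.matched-unique d∈C d~v
  ... | no _    | inj₂ (inj₂ (_ , d∈C)) = PC.matched-unique d∈C d~v

  doubled⇒uncovered-incident : ∀ {d v} → Doubled d → Incident G d v →
    ∃ λ c → Uncovered c × Incident G c v
  doubled⇒uncovered-incident (inj₁ (d∈A , d∈B)) d~v =
    shared-edge⇒uncovered-neighbour cubic pmA pmB pmC regular d∈A d∈B d~v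
  doubled⇒uncovered-incident (inj₂ (inj₁ (d∈A , d∈C))) d~v
    with c , (c∉A , c∉C , c∉B) , c~v ← shared-edge⇒uncovered-neighbour cubic pmA pmC pmB
           (λ e∈A e∈C e∈B → regular e∈A e∈B e∈C) d∈A d∈C d~v
    = c , (c∉A , c∉B , c∉C) , c~v
  doubled⇒uncovered-incident (inj₂ (inj₂ (d∈B , d∈C))) d~v
    with c , (c∉B , c∉C , c∉A) , c~v ← shared-edge⇒uncovered-neighbour cubic pmB pmC pmA
           (λ e∈B e∈C e∈A → regular e∈A e∈B e∈C) d∈B d∈C d~v
    = c , (c∉A , c∉B , c∉C) , c~v

  record Dart : Set where
    field
      vertex         : V G
      edge           : E G
      edge-uncovered : Uncovered edge
      edge-incident  : Incident G edge vertex
  open Dart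

  crossUncovered : Dart → Dart
  crossUncovered s = record
    { vertex = otherEnd (edge s) (vertex s) ; edge = edge s ; edge-uncovered = edge-uncovered s
    ; edge-incident = joins⇒incidentʳ (joins-otherEnd (edge-incident s)) }

  doubledEdge-at : ∀ s → Doubled (doubledEdge (vertex s))
  doubledEdge-at s = doubledEdge-doubled (edge-uncovered s) (edge-incident s)

  crossDoubled : Dart → Dart
  crossDoubled s = record
    { vertex = w ; edge = proj₁ found
    ; edge-uncovered = proj₁ (proj₂ found) ; edge-incident = proj₂ (proj₂ found) }
    where
    w = otherEnd (doubledEdge (vertex s)) (vertex s)
    found = doubled⇒uncovered-incident (doubledEdge-at s)
              (joins⇒incidentʳ (joins-otherEnd (doubledEdge-incident (vertex s))))

  cross : Bool → Dart → Dart
  cross true  = crossUncovered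
  cross false = crossDoubled

  crossed : Bool → Dart → E G
  crossed true  s = edge s
  crossed false s = doubledEdge (vertex s)

  crossed-joins : ∀ b s → Joins G (crossed b s) (vertex s) (vertex (cross b s))
  crossed-joins true  s = joins-otherEnd (edge-incident s)
  crossed-joins false s = joins-otherEnd (doubledEdge-incident (vertex s))

  crossed-determined : ∀ b {s s′} → vertex s ≡ vertex s′ → crossed b s ≡ crossed b s′
  crossed-determined true  {s} {s′} eq = uncovered-unique (edge-uncovered s) (edge-uncovered s′)
    (edge-incident s) (subst (Incident G (edge s′)) (sym eq) (edge-incident s′))
  crossed-determined false eq = cong doubledEdge eq

  crossed-back : ∀ b s → crossed b (cross b s) ≡ crossed b s
  crossed-back true  s = refl
  crossed-back false s =
    sym (doubled⇒doubledEdge (doubledEdge-at s) (joins⇒incidentʳ (crossed-joins false s)))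

  crossed-nonLoop : ∀ b s → ¬ IsLoop G (crossed b s)
  crossed-nonLoop true  s = uncovered-nonLoop (edge-uncovered s) (edge-incident s)
  crossed-nonLoop false s = doubled⇒nonLoop (doubledEdge-at s)

  crossed-kind : ∀ {b b′} s s′ → crossed b s ≡ crossed b′ s′ → b ≡ b′
  crossed-kind {true}  {true}  _ _ _ = refl
  crossed-kind {false} {false} _ _ _ = refl
  crossed-kind {true}  {false} s s′ eq =
    ⊥-elim (uncovered≢covered (edge-uncovered s) (doubled⇒covered (doubledEdge-at s′)) eq)
  crossed-kind {false} {true}  s s′ eq =
    ⊥-elim (uncovered≢covered (edge-uncovered s′) (doubled⇒covered (doubledEdge-at s)) (sym eq))

  srcDart : ∀ {u} → Uncovered u → Dart
  srcDart {u} u-unc = record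
    { vertex = Graph.src G u ; edge = u ; edge-uncovered = u-unc ; edge-incident = inj₁ refl }

  open AlternatingWalk {G} vertex crossed cross
    crossed-joins crossed-determined crossed-back crossed-nonLoop crossed-kind
    using (alternating-circuit)

  girth≤2*uncovered : ¬ ThreeEdgeColourable G → ∀ {g} → (∀ l → HasCircuitOfLength G l → g ≤ l) →
    g ≤ 2 * uncovered G A B C
  girth≤2*uncovered ¬colourable {g} shortest =
    bound (alternating-circuit (srcDart (proj₂ (uncovered-edge ¬colourable))))
    where
    bound : (∃ λ k → Circuit G (k + suc k) × Σ (Fin (suc k) → Dart) λ h → Injective _≡_ _≡_ (edge ∘ h)) →
      g ≤ 2 * uncovered G A B C
    bound (k , circuit , h , h-injective) = begin
      g                      ≤⟨ shortest _ circuit ⟩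
      suc k + suc k          ≡⟨ cong (suc k +_) (+-identityʳ (suc k)) ⟨
      2 * suc k              ≤⟨ *-monoʳ-≤ 2 (injective⇒≤∣p∣ (edge ∘ h) h-injective
                                                (uncovered⇒∈∁ ∘ edge-uncovered ∘ h)) ⟩
      2 * uncovered G A B C  ∎
      where open ≤-Reasoning

proposition4p1 : (G : Graph) → Snark G → (g r : ℕ) → IsGirth G g → IsRdf G r →
    g ≤ 2 * r
proposition4p1 G (_ , cubic , ¬colourable) g r (_ , shortest)
  ((A , B , C , (pmA , pmB , pmC , A∩B∩C≡∅) , uncovered≡r) , _) =
  subst (λ n → g ≤ 2 * n) uncovered≡r
    (RegularArray.girth≤2*uncovered cubic pmA pmB pmC (∩≡∅⇒disjoint A∩B∩C≡∅) ¬colourable shortest)
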